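{- Let $K$ be a finite simplicial complex with nonempty vertex set and $s\ge1$ an integer. Then for every integer $r\ge1$, \[ \chi^s(K,r)=\sum_{P\in \mathrm{BCP}^s(K)} \chi^1(G_0(P),r), \] and the $s$-chromatic number of $K$ is \[ \chi^s(K)=\min_{P\in\mathrm{BCP}^s(K)} \chi^1(G_0(P)). \]
   Context: An $s$-simplex of $K$ is a face with $s+1$ vertices. An $(r,s)$-coloring of $K$ is a map $V(K)\to\{1,\dots,r\}$ with no monochrome $s$-simplex; $\chi^s(K,r)$ is the number of such colorings and $\chi^s(K)$ the least $r\ge1$ with $\chi^s(K,r)>0$. For a simple graph $G$, $\chi^1(G,r)$ is its usual chromatic polynomial (number of proper vertex colorings with $r$ colors) and $\chi^1(G)$ its chromatic number. A set $B\subseteq V(K)$ is $s$-independent if it contains no $s$-simplex of $K$, and connected if $K\cap D[B]$ (the faces of $K$ contained in $B$) is a connected simplicial complex. A partition of $V(K)$ is block-connected if all its blocks are connected; $\mathrm{BCP}^s(K)$ is the set of block-connected partitions of $V(K)$ all of whose blocks are $s$-independent. For a partition $P$, $G_0(P)$ is the simple graph with vertex set the blocks of $P$, two blocks joined by an edge iff their union is connected. -}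

module Defs where

open import Data.Bool using (Bool; true; false; T; _∧_; _∨_; not)
open import Data.Nat using (ℕ; zero; suc; _≤_; _<_; _≡ᵇ_; _<ᵇ_)
open import Data.Fin using (Fin; toℕ)
open import Data.Fin.Subset using (Subset; _⊆_; ⁅_⁆; ∣_∣; _∩_; _∪_; ∁)
open import Data.Vec using (Vec; []; _∷_; lookup; tabulate)
open import Data.List using (List; []; _∷_; [_]; map; concatMap; allFin; length; filterᵇ; upTo)
open import Data.Bool.ListAction using (all; any)
open import Data.Nat.ListAction using (sum)
open import Data.Product using (Σ; _×_)
open import Relation.Binary.PropositionalEquality using (_≡_)

allVecs : {A : Set} → List A → (n : ℕ) → List (Vec A n)
allVecs xs zero    = [ [] ]
allVecs xs (suc n) = concatMap (λ x → map (x ∷_) (allVecs xs n)) xs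

allSubsets : (n : ℕ) → List (Subset n)
allSubsets n = allVecs (true ∷ false ∷ []) n

count : {A : Set} → (A → Bool) → List A → ℕ
count p xs = length (filterᵇ p xs)

_≡ᶠ_ : {m : ℕ} → Fin m → Fin m → Bool
i ≡ᶠ j = toℕ i ≡ᵇ toℕ j

_⊆ᵇ_ : {n : ℕ} → Subset n → Subset n → Bool
_⊆ᵇ_ {n} σ τ = all (λ v → not (lookup σ v) ∨ lookup τ v) (allFin n)

nonemptyᵇ : {n : ℕ} → Subset n → Bool
nonemptyᵇ {n} σ = any (λ v → lookup σ v) (allFin n)

-- Faces are given by a decidable (boolean) predicate on subsets,
-- closed under taking subsets, and every vertex {v} is a face
-- (so V(K) = Fin n).

record SimplicialComplex (n : ℕ) : Set where
  field
    face       : Subset n → Bool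
    downClosed : ∀ σ τ → τ ⊆ σ → T (face σ) → T (face τ)
    vertexFace : ∀ v → T (face ⁅ v ⁆)
open SimplicialComplex public

module _ {n : ℕ} (K : SimplicialComplex n) (s : ℕ) where

  isSimplex : Subset n → Bool
  isSimplex σ = face K σ ∧ (∣ σ ∣ ≡ᵇ suc s)

  -- a coloring V(K) → {1..r} is represented as c : Vec (Fin r) n
  -- (vertex v gets color lookup c v); σ is monochrome under c
  monochrome : {r : ℕ} → Vec (Fin r) n → Subset n → Bool
  monochrome {r} c σ =
    any (λ k → all (λ v → not (lookup σ v) ∨ (lookup c v ≡ᶠ k)) (allFin n)) (allFin r)

  isColoring : {r : ℕ} → Vec (Fin r) n → Bool
  isColoring c = not (any (λ σ → isSimplex σ ∧ monochrome c σ) (allSubsets n))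

  χˢ : ℕ → ℕ
  χˢ r = count isColoring (allVecs (allFin r) n)

  independent : Subset n → Bool
  independent B = not (any (λ σ → isSimplex σ ∧ (σ ⊆ᵇ B)) (allSubsets n))

-- B is connected: the complex K ∩ D[B] is connected, i.e. it is not the
-- disjoint union of two nonempty subcomplexes: there is no splitting
-- B = S ⊔ (B ∖ S) with S, B ∖ S nonempty and every face of K contained
-- in B lying entirely in S or entirely in B ∖ S.
connected : {n : ℕ} → SimplicialComplex n → Subset n → Bool
connected {n} K B = not (any splits (allSubsets n))
  where
  splits : Subset n → Bool
  splits S = (S ⊆ᵇ B) ∧ nonemptyᵇ S ∧ nonemptyᵇ (B ∩ ∁ S)
           ∧ all (λ σ → not (face K σ ∧ (σ ⊆ᵇ B)) ∨ (σ ⊆ᵇ S) ∨ (σ ⊆ᵇ (B ∩ ∁ S)))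
                 (allSubsets n)

-- A partition with m blocks is represented canonically by a labeling
-- f : Vec (Fin m) n (vertex v lies in block lookup f v) which is
-- surjective and in "first occurrence order": whenever label j < f v,
-- j already occurs at some vertex u < v.  Each partition of Fin n has
-- exactly one such canonical representation (m, f).

canonical : {n m : ℕ} → Vec (Fin m) n → Bool
canonical {n} {m} f =
  all (λ i → any (λ v → lookup f v ≡ᶠ i) (allFin n)) (allFin m)
  ∧ all (λ v → all (λ j → not (toℕ j <ᵇ toℕ (lookup f v))
                          ∨ any (λ u → (toℕ u <ᵇ toℕ v) ∧ (lookup f u ≡ᶠ j)) (allFin n))
                   (allFin m))
        (allFin n)

block : {n m : ℕ} → Vec (Fin m) n → Fin m → Subset n
block f i = tabulate (λ v → lookup f v ≡ᶠ i)

inBCP : {n m : ℕ} → SimplicialComplex n → ℕ → Vec (Fin m) n → Bool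
inBCP {n} {m} K s f =
  canonical f ∧ all (λ i → connected K (block f i) ∧ independent K s (block f i)) (allFin m)

-- Simple graphs on Fin m, given by a (symmetric, irreflexive) adjacency.

chromaticPoly : {m : ℕ} → (Fin m → Fin m → Bool) → ℕ → ℕ
chromaticPoly {m} adj r =
  count (λ c → all (λ i → all (λ j → not (adj i j) ∨ not (lookup c i ≡ᶠ lookup c j))
                              (allFin m)) (allFin m))
        (allVecs (allFin r) m)

G₀ : {n m : ℕ} → SimplicialComplex n → Vec (Fin m) n → Fin m → Fin m → Bool
G₀ K f i j = not (i ≡ᶠ j) ∧ connected K (block f i ∪ block f j)

bcpSum : {n : ℕ} → SimplicialComplex n → ℕ → ℕ → ℕ
bcpSum {n} K s r =
  sum (map (λ m → sum (map (λ f → chromaticPoly (G₀ K f) r)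
                           (filterᵇ (inBCP K s) (allVecs (allFin m) n))))
           (upTo (suc n)))

IsLeastColors : (ℕ → ℕ) → ℕ → Set
IsLeastColors f k = (1 ≤ k) × (0 < f k) × (∀ r → 1 ≤ r → r < k → f r ≡ 0)

IsMinBCPChromatic : {n : ℕ} → SimplicialComplex n → ℕ → ℕ → Set
IsMinBCPChromatic {n} K s k =
  Σ ℕ (λ m → Σ (Vec (Fin m) n) (λ f →
      T (inBCP K s f) × IsLeastColors (chromaticPoly (G₀ K f)) k))
  × (∀ m (f : Vec (Fin m) n) → T (inBCP K s f) →
       ∀ k' → IsLeastColors (chromaticPoly (G₀ K f)) k' → k ≤ k')

module Submission where

-- Every (r,s)-coloring x of K determines a unique pair (P, c): P is the partition of V(K) into
-- the components of the color classes of x, which is block-connected and s-independent because x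
-- has no monochrome s-simplex, and c colors the blocks of P properly in G₀(P) because two blocks
-- whose union is connected but which carry the same color would form one component. Conversely
-- every such pair (P, c) composes to an (r,s)-coloring. Counting both sides of this bijection gives
-- the polynomial identity, and the chromatic numbers follow because χˢ(K, r) is a sum of the
-- nonnegative terms χ¹(G₀(P), r). The partition of x is not built directly: starting from the
-- partition into singletons, two adjacent blocks of equal color are merged as long as there are any.

open import Data.Bool using (Bool; true; false; T; not; _∧_; _∨_)
open import Data.Bool.ListAction using (all; any)
open import Data.Bool.Properties using (T-≡; T-∧; T-∨)
open import Data.Empty using (⊥-elim)
open import Data.Fin using (Fin; toℕ; fromℕ<; punchIn; punchOut) renaming (_<_ to _<ᶠ_)
open import Data.Fin.Induction using (<-wellFounded)
open import Data.Fin.Properties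
  using (toℕ-injective; toℕ-fromℕ<; toℕ<n; injective⇒≤; any?; <-cmp; ≤∧≢⇒<; <⇒≢;
         punchInᵢ≢i; punchIn-mono-≤; punchIn-injective; punchIn-punchOut; punchOut-punchIn;
         punchOut-cong; punchOut-injective)
  renaming (_≟_ to _≟ᶠ_)
open import Data.Fin.Subset
  using (Subset; _∈_; _⊆_; _∪_; _∩_; ∁; ⁅_⁆; ∣_∣; Nonempty; Empty) renaming (⊥ to ⊥ˢ)
open import Data.Fin.Subset.Properties
  using (x∈⁅x⁆; x∈⁅y⁆⇒x≡y; x∈p∪q⁺; x∈p∪q⁻; x∈p∩q⁺; x∈p∩q⁻; x∈∁p⇒x∉p; x∉p⇒x∈∁p;
         x∉∁p⇒x∈p; nonempty?; anySubset?; _⊆?_; p⊆p∪q; q⊆p∪q; p∩q⊆p; p∩q⊆q; p⊆q⇒∁p⊇∁q;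
         ⊆-antisym; ∪-comm; Empty-unique; ∣⊥∣≡0; p⊆q⇒∣p∣≤∣q∣; ∣⁅x⁆∣≡1)
open import Data.List
  using (List; []; _∷_; allFin; map; concatMap; cartesianProductWith; _++_; filterᵇ; upTo)
open import Data.List.Membership.Propositional using (lose) renaming (_∈_ to _∈ˡ_)
open import Data.List.Membership.Propositional.Properties
  using (∈-allFin; ∈-cartesianProductWith⁺; ∈-upTo⁺; ∈-filter⁺; ∈-filter⁻)
open import Data.List.Properties using (map-cong)
open import Data.List.Relation.Unary.All as All using (All; []; _∷_)
open import Data.List.Relation.Unary.All.Properties using (all⁺; all⁻)
open import Data.List.Relation.Unary.AllPairs using ([]; _∷_)
open import Data.List.Relation.Unary.Any as Any using (here; there)
open import Data.List.Relation.Unary.Any.Properties using (any⁺; any⁻)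
open import Data.List.Relation.Unary.Unique.Propositional using (Unique)
open import Data.List.Relation.Unary.Unique.Propositional.Properties
  using (cartesianProductWith⁺; upTo⁺; allFin⁺)
open import Data.Nat using (ℕ; zero; suc; _+_; _≤_; _<_; _<ᵇ_; z≤n; s≤s)
open import Data.Nat.ListAction using (sum)
open import Data.Nat.Properties
  using (+-commutativeSemigroup; ≡ᵇ⇒≡; ≡⇒≡ᵇ; <ᵇ⇒<; <⇒<ᵇ; 0≢1+n; n≤0⇒n≡0; m≤m+n; m≤n+m;
         +-identityʳ; ≤-refl; ≤-reflexive; ≤-trans; ≤-antisym; <⇒≤; ≮⇒≥; <-irrefl; <-trans;
         <-≤-trans; module ≤-Reasoning)
open import Algebra.Properties.CommutativeSemigroup +-commutativeSemigroup
  using () renaming (interchange to +-interchange)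
open import Data.Product using (Σ; ∃; _×_; _,_; proj₁; proj₂)
open import Data.Sum as Sum using (_⊎_; inj₁; inj₂)
open import Data.Vec using (Vec; []; lookup; tabulate) renaming (_∷_ to _∷ᵛ_; map to mapᵛ)
open import Data.Vec.Properties
  using (≡-dec; []=⇒lookup; lookup⇒[]=; ∷-injective; lookup∘tabulate; lookup-map;
         tabulate∘lookup; tabulate-cong)
open import Defs
open import Function using (_∘_)
open import Function.Bundles using (Equivalence)
open import Induction.WellFounded using (Acc; acc)
open import Relation.Binary.Definitions using (DecidableEquality; tri<; tri≈; tri>)
open import Relation.Binary.PropositionalEquality
  using (_≡_; _≢_; refl; sym; trans; cong; cong₂; subst; module ≡-Reasoning)
open import Relation.Nullary using (¬_; yes; no)
open import Relation.Nullary.Decidable using (T?; _×-dec_; isYes; toWitness; fromWitness)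

T-not⁻ : ∀ {b} → T (not b) → ¬ T b
T-not⁻ {false} _ ()

T-not⁺ : ∀ {b} → ¬ T b → T (not b)
T-not⁺ {true}  ¬b = ¬b _
T-not⁺ {false} _  = _

T-→⁻ : ∀ {a b} → T (not a ∨ b) → T a → T b
T-→⁻ {true} b _ = b

T-→⁺ : ∀ {a b} → (T a → T b) → T (not a ∨ b)
T-→⁺ {true}  a→b = a→b _
T-→⁺ {false} _   = _

T-∧⁻ : ∀ a {b} → T (a ∧ b) → T a × T b
T-∧⁻ a = Equivalence.to (T-∧ {a})

T-∧⁺ : ∀ {a b} → T a → T b → T (a ∧ b)
T-∧⁺ a b = Equivalence.from T-∧ (a , b)

T-∨⁻ : ∀ a {b} → T (a ∨ b) → T a ⊎ T b
T-∨⁻ a = Equivalence.to (T-∨ {a})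

T-∨⁺ : ∀ a b → T a ⊎ T b → T (a ∨ b)
T-∨⁺ a b = Equivalence.from (T-∨ {a} {b})

module _ {A : Set} {xs : List A} (complete : ∀ x → x ∈ˡ xs) {p : A → Bool} where

  all⇒∀ : T (all p xs) → ∀ x → T (p x)
  all⇒∀ t x = All.lookup (all⁺ p xs t) (complete x)

  ∀⇒all : (∀ x → T (p x)) → T (all p xs)
  ∀⇒all h = all⁻ p {xs} (All.tabulate (λ {x} _ → h x))

  any⇒∃ : T (any p xs) → ∃ λ x → T (p x)
  any⇒∃ t = Any.satisfied (any⁻ p xs t)

  ∃⇒any : ∀ x → T (p x) → T (any p xs)
  ∃⇒any x px = any⁺ p (lose (complete x) px)

module _ {A : Set} where

  allVecs-suc : ∀ (xs : List A) n → allVecs xs (suc n) ≡ cartesianProductWith _∷ᵛ_ xs (allVecs xs n)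
  allVecs-suc xs n = go xs
    where
    go : ∀ ys → concatMap (λ y → map (y ∷ᵛ_) (allVecs xs n)) ys
              ≡ cartesianProductWith _∷ᵛ_ ys (allVecs xs n)
    go []       = refl
    go (y ∷ ys) = cong (map (y ∷ᵛ_) (allVecs xs n) ++_) (go ys)

  ∈-allVecs : ∀ {xs : List A} → (∀ x → x ∈ˡ xs) → ∀ {n} (v : Vec A n) → v ∈ˡ allVecs xs n
  ∈-allVecs complete []        = here refl
  ∈-allVecs {xs} complete (x ∷ᵛ v) =
    subst (_ ∈ˡ_) (sym (allVecs-suc xs _))
          (∈-cartesianProductWith⁺ _∷ᵛ_ (complete x) (∈-allVecs complete v))

  allVecs⁺ : ∀ {xs : List A} → Unique xs → ∀ n → Unique (allVecs xs n)
  allVecs⁺ u zero    = [] ∷ []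
  allVecs⁺ {xs} u (suc n) =
    subst Unique (sym (allVecs-suc xs n)) (cartesianProductWith⁺ _∷ᵛ_ ∷-injective u (allVecs⁺ u n))

allFinVecs : ∀ r n → List (Vec (Fin r) n)
allFinVecs r n = allVecs (allFin r) n

∈-allFinVecs : ∀ {r n} (v : Vec (Fin r) n) → v ∈ˡ allFinVecs r n
∈-allFinVecs = ∈-allVecs ∈-allFin

allFinVecs⁺ : ∀ r n → Unique (allFinVecs r n)
allFinVecs⁺ r = allVecs⁺ (allFin⁺ r)

∈-allSubsets : ∀ {n} (σ : Subset n) → σ ∈ˡ allSubsets n
∈-allSubsets = ∈-allVecs λ { true → here refl ; false → there (here refl) }

module _ {n : ℕ} where

  lookup⇒∈ : ∀ {σ : Subset n} {v} → T (lookup σ v) → v ∈ σ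
  lookup⇒∈ {σ} {v} t = lookup⇒[]= v σ (Equivalence.to T-≡ t)

  ∈⇒lookup : ∀ {σ : Subset n} {v} → v ∈ σ → T (lookup σ v)
  ∈⇒lookup v∈σ = Equivalence.from T-≡ ([]=⇒lookup v∈σ)

  ⊆ᵇ⇒⊆ : ∀ {σ τ : Subset n} → T (σ ⊆ᵇ τ) → σ ⊆ τ
  ⊆ᵇ⇒⊆ t {v} v∈σ = lookup⇒∈ (T-→⁻ (all⇒∀ ∈-allFin t v) (∈⇒lookup v∈σ))

  ⊆⇒⊆ᵇ : ∀ {σ τ : Subset n} → σ ⊆ τ → T (σ ⊆ᵇ τ)
  ⊆⇒⊆ᵇ σ⊆τ = ∀⇒all ∈-allFin λ v → T-→⁺ λ v∈σ → ∈⇒lookup (σ⊆τ (lookup⇒∈ {v = v} v∈σ))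

  nonemptyᵇ⇒Nonempty : ∀ {σ : Subset n} → T (nonemptyᵇ σ) → Nonempty σ
  nonemptyᵇ⇒Nonempty t = let v , v∈σ = any⇒∃ ∈-allFin t in v , lookup⇒∈ v∈σ

  Nonempty⇒nonemptyᵇ : ∀ {σ : Subset n} → Nonempty σ → T (nonemptyᵇ σ)
  Nonempty⇒nonemptyᵇ (v , v∈σ) = ∃⇒any ∈-allFin v (∈⇒lookup v∈σ)

  Empty∩∁⇒⊆ : ∀ {σ S : Subset n} → Empty (σ ∩ ∁ S) → σ ⊆ S
  Empty∩∁⇒⊆ empty v∈σ = x∉∁p⇒x∈p (λ v∈∁S → empty (_ , x∈p∩q⁺ (v∈σ , v∈∁S)))

  Empty∩⇒⊆∁ : ∀ {σ S : Subset n} → Empty (σ ∩ S) → σ ⊆ ∁ S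
  Empty∩⇒⊆∁ empty v∈σ = x∉p⇒x∈∁p (λ v∈S → empty (_ , x∈p∩q⁺ (v∈σ , v∈S)))

  ⁅x⁆⊆ : ∀ {C : Subset n} {x} → x ∈ C → ⁅ x ⁆ ⊆ C
  ⁅x⁆⊆ {C} x∈C y∈⁅x⁆ = subst (_∈ C) (sym (x∈⁅y⁆⇒x≡y _ y∈⁅x⁆)) x∈C

  ∪-least : ∀ {A B C : Subset n} → A ⊆ C → B ⊆ C → A ∪ B ⊆ C
  ∪-least {A} {B} A⊆C B⊆C v∈A∪B with x∈p∪q⁻ A B v∈A∪B
  ... | inj₁ v∈A = A⊆C v∈A
  ... | inj₂ v∈B = B⊆C v∈B

-- Connectivity

module _ {n : ℕ} (K : SimplicialComplex n) where

  IsFace : Subset n → Set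
  IsFace σ = T (face K σ)

  record Splits (B S : Subset n) : Set where
    field
      S⊆B          : S ⊆ B
      S-nonempty   : Nonempty S
      B∖S-nonempty : Nonempty (B ∩ ∁ S)
      one-sided    : ∀ {σ} → IsFace σ → σ ⊆ B → σ ⊆ S ⊎ σ ⊆ ∁ S

  Connected : Subset n → Set
  Connected B = ∀ S → ¬ Splits B S

  private
    -- the predicate `splits` local to `connected`
    splitsᵇ : Subset n → Subset n → Bool
    splitsᵇ B S = (S ⊆ᵇ B) ∧ nonemptyᵇ S ∧ nonemptyᵇ (B ∩ ∁ S)
                ∧ all (λ σ → not (face K σ ∧ (σ ⊆ᵇ B)) ∨ (σ ⊆ᵇ S) ∨ (σ ⊆ᵇ (B ∩ ∁ S)))
                      (allSubsets n)

    one-sidedᵇ⇒ : ∀ {σ B S : Subset n} → T ((σ ⊆ᵇ S) ∨ (σ ⊆ᵇ (B ∩ ∁ S))) →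
                  σ ⊆ S ⊎ σ ⊆ ∁ S
    one-sidedᵇ⇒ {σ} {B} {S} t with T-∨⁻ (σ ⊆ᵇ S) t
    ... | inj₁ σ⊆S   = inj₁ (⊆ᵇ⇒⊆ σ⊆S)
    ... | inj₂ σ⊆B∖S = inj₂ (p∩q⊆q B (∁ S) ∘ ⊆ᵇ⇒⊆ σ⊆B∖S)

    ⇒one-sidedᵇ : ∀ {σ B S : Subset n} → σ ⊆ B → σ ⊆ S ⊎ σ ⊆ ∁ S →
                  T ((σ ⊆ᵇ S) ∨ (σ ⊆ᵇ (B ∩ ∁ S)))
    ⇒one-sidedᵇ {σ} {B} {S} σ⊆B σ-side = T-∨⁺ (σ ⊆ᵇ S) (σ ⊆ᵇ (B ∩ ∁ S))
      (Sum.map ⊆⇒⊆ᵇ (λ σ⊆∁S → ⊆⇒⊆ᵇ λ v∈σ → x∈p∩q⁺ (σ⊆B v∈σ , σ⊆∁S v∈σ)) σ-side)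

    splitsᵇ⇒Splits : ∀ {B S : Subset n} → T (splitsᵇ B S) → Splits B S
    splitsᵇ⇒Splits {B} {S} t =
      let S⊆B   , t     = T-∧⁻ (S ⊆ᵇ B) t
          S≢∅   , t     = T-∧⁻ (nonemptyᵇ S) t
          B∖S≢∅ , faces = T-∧⁻ (nonemptyᵇ (B ∩ ∁ S)) t
      in record
        { S⊆B          = ⊆ᵇ⇒⊆ S⊆B
        ; S-nonempty   = nonemptyᵇ⇒Nonempty S≢∅
        ; B∖S-nonempty = nonemptyᵇ⇒Nonempty B∖S≢∅
        ; one-sided    = λ {σ} σ-face σ⊆B →
            one-sidedᵇ⇒ {B = B} (T-→⁻ (all⇒∀ ∈-allSubsets faces σ)
                                      (T-∧⁺ σ-face (⊆⇒⊆ᵇ σ⊆B)))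
        }

    Splits⇒splitsᵇ : ∀ {B S : Subset n} → Splits B S → T (splitsᵇ B S)
    Splits⇒splitsᵇ {B} {S} sp =
      T-∧⁺ (⊆⇒⊆ᵇ S⊆B) (T-∧⁺ (Nonempty⇒nonemptyᵇ S-nonempty)
        (T-∧⁺ (Nonempty⇒nonemptyᵇ B∖S-nonempty) (∀⇒all ∈-allSubsets λ σ → T-→⁺ λ t →
          let σ-face , σ⊆B = T-∧⁻ (face K σ) t
          in ⇒one-sidedᵇ {B = B} (⊆ᵇ⇒⊆ σ⊆B) (one-sided σ-face (⊆ᵇ⇒⊆ σ⊆B)))))
      where open Splits sp

  connected⇒Connected : ∀ {B : Subset n} → T (connected K B) → Connected B
  connected⇒Connected t S sp = T-not⁻ t (∃⇒any ∈-allSubsets S (Splits⇒splitsᵇ sp))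

  Connected⇒connected : ∀ {B : Subset n} → Connected B → T (connected K B)
  Connected⇒connected conn = T-not⁺ λ t →
    let S , t = any⇒∃ ∈-allSubsets t in conn S (splitsᵇ⇒Splits t)

  Splits⇒¬one-sided : ∀ {B S : Subset n} → Splits B S → ¬ (B ⊆ S ⊎ B ⊆ ∁ S)
  Splits⇒¬one-sided sp (inj₁ B⊆S) =
    let _ , v∈B∖S = Splits.B∖S-nonempty sp
        v∈B , v∈∁S = x∈p∩q⁻ _ _ v∈B∖S
    in x∈∁p⇒x∉p v∈∁S (B⊆S v∈B)
  Splits⇒¬one-sided sp (inj₂ B⊆∁S) =
    let _ , v∈S = Splits.S-nonempty sp in x∈∁p⇒x∉p (B⊆∁S (Splits.S⊆B sp v∈S)) v∈S

  Connected-⁅⁆ : ∀ v → Connected ⁅ v ⁆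
  Connected-⁅⁆ v S sp =
    let u , u∈S = Splits.S-nonempty sp
        v∈S = subst (_∈ S) (x∈⁅y⁆⇒x≡y v (Splits.S⊆B sp u∈S)) u∈S
    in Splits⇒¬one-sided sp (inj₁ (⁅x⁆⊆ v∈S))

  Connected⇒one-sided : ∀ {A S : Subset n} → Connected A →
                        (∀ {σ} → IsFace σ → σ ⊆ A → σ ⊆ S ⊎ σ ⊆ ∁ S) → A ⊆ S ⊎ A ⊆ ∁ S
  Connected⇒one-sided {A} {S} conn faces with nonempty? (A ∩ ∁ S)
  ... | no  A∖S-empty    = inj₁ (Empty∩∁⇒⊆ A∖S-empty)
  ... | yes (v , v∈A∖S) = inj₂ (Empty∩⇒⊆∁ λ A∩S-nonempty → conn (A ∩ S) record
      { S⊆B          = p∩q⊆p A S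
      ; S-nonempty   = A∩S-nonempty
      ; B∖S-nonempty = v , x∈p∩q⁺ (p∩q⊆p A (∁ S) v∈A∖S , ∁S⊆∁A∩S (p∩q⊆q A (∁ S) v∈A∖S))
      ; one-sided    = λ σ-face σ⊆A →
          Sum.map (λ σ⊆S v∈σ → x∈p∩q⁺ (σ⊆A v∈σ , σ⊆S v∈σ)) (λ σ⊆∁S v∈σ → ∁S⊆∁A∩S (σ⊆∁S v∈σ))
                  (faces σ-face σ⊆A)
      })
    where
    ∁S⊆∁A∩S : ∁ S ⊆ ∁ (A ∩ S)
    ∁S⊆∁A∩S = p⊆q⇒∁p⊇∁q (p∩q⊆q A S)

  Connected-∪ : ∀ {A B σ : Subset n} {a b} → Connected A → Connected B →
                IsFace σ → a ∈ σ → b ∈ σ → a ∈ A → b ∈ B → Connected (A ∪ B)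
  Connected-∪ {A} {B} {σ} {a} {b} A-conn B-conn σ-face a∈σ b∈σ a∈A b∈B S sp =
    Splits⇒¬one-sided sp (combine (Connected⇒one-sided A-conn (restrict (p⊆p∪q B)))
                                  (Connected⇒one-sided B-conn (restrict (q⊆p∪q A B)))
                                  (one-sided edge-face edge⊆A∪B))
    where
    open Splits sp

    restrict : ∀ {C : Subset n} → C ⊆ A ∪ B → ∀ {τ} → IsFace τ → τ ⊆ C → τ ⊆ S ⊎ τ ⊆ ∁ S
    restrict C⊆A∪B τ-face τ⊆C = one-sided τ-face (C⊆A∪B ∘ τ⊆C)

    edge = ⁅ a ⁆ ∪ ⁅ b ⁆

    a∈edge : a ∈ edge
    a∈edge = p⊆p∪q ⁅ b ⁆ (x∈⁅x⁆ a)

    b∈edge : b ∈ edge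
    b∈edge = q⊆p∪q ⁅ a ⁆ ⁅ b ⁆ (x∈⁅x⁆ b)

    edge-face : IsFace edge
    edge-face = downClosed K σ edge (∪-least (⁅x⁆⊆ a∈σ) (⁅x⁆⊆ b∈σ)) σ-face

    edge⊆A∪B : edge ⊆ A ∪ B
    edge⊆A∪B = ∪-least (⁅x⁆⊆ (p⊆p∪q B a∈A)) (⁅x⁆⊆ (q⊆p∪q A B b∈B))

    combine : A ⊆ S ⊎ A ⊆ ∁ S → B ⊆ S ⊎ B ⊆ ∁ S → edge ⊆ S ⊎ edge ⊆ ∁ S →
              A ∪ B ⊆ S ⊎ A ∪ B ⊆ ∁ S
    combine (inj₁ A⊆S)  (inj₁ B⊆S)  _           = inj₁ (∪-least A⊆S B⊆S)
    combine (inj₂ A⊆∁S) (inj₂ B⊆∁S) _           = inj₂ (∪-least A⊆∁S B⊆∁S)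
    combine (inj₁ _)    (inj₂ B⊆∁S) (inj₁ e⊆S)  = ⊥-elim (x∈∁p⇒x∉p (B⊆∁S b∈B) (e⊆S b∈edge))
    combine (inj₁ A⊆S)  (inj₂ _)    (inj₂ e⊆∁S) = ⊥-elim (x∈∁p⇒x∉p (e⊆∁S a∈edge) (A⊆S a∈A))
    combine (inj₂ A⊆∁S) (inj₁ _)    (inj₁ e⊆S)  = ⊥-elim (x∈∁p⇒x∉p (A⊆∁S a∈A) (e⊆S a∈edge))
    combine (inj₂ _)    (inj₁ B⊆S)  (inj₂ e⊆∁S) = ⊥-elim (x∈∁p⇒x∉p (e⊆∁S b∈edge) (B⊆S b∈B))

  crossing-face : ∀ {B S : Subset n} → Connected B → S ⊆ B → Nonempty S → Nonempty (B ∩ ∁ S) →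
                  ∃ λ σ → IsFace σ × σ ⊆ B × Nonempty (σ ∩ S) × Nonempty (σ ∩ ∁ S)
  crossing-face {B} {S} conn S⊆B S≢∅ B∖S≢∅
    with anySubset? {P = λ σ → IsFace σ × σ ⊆ B × Nonempty (σ ∩ S) × Nonempty (σ ∩ ∁ S)}
           (λ σ → T? (face K σ) ×-dec σ ⊆? B ×-dec nonempty? (σ ∩ S) ×-dec nonempty? (σ ∩ ∁ S))
  ... | yes crossing = crossing
  ... | no ¬crossing = ⊥-elim (conn S record
      { S⊆B = S⊆B ; S-nonempty = S≢∅ ; B∖S-nonempty = B∖S≢∅ ; one-sided = one-sided })
    where
    one-sided : ∀ {σ} → IsFace σ → σ ⊆ B → σ ⊆ S ⊎ σ ⊆ ∁ S
    one-sided {σ} σ-face σ⊆B with nonempty? (σ ∩ S) | nonempty? (σ ∩ ∁ S)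
    ... | no  σ∩S-empty | _                = inj₂ (Empty∩⇒⊆∁ σ∩S-empty)
    ... | yes _         | no  σ∖S-empty    = inj₁ (Empty∩∁⇒⊆ σ∖S-empty)
    ... | yes σ∩S≢∅     | yes σ∖S≢∅        = ⊥-elim (¬crossing (σ , σ-face , σ⊆B , σ∩S≢∅ , σ∖S≢∅))

-- Partitions as canonical labelings

≡ᶠ⇒≡ : ∀ {m} {i j : Fin m} → T (i ≡ᶠ j) → i ≡ j
≡ᶠ⇒≡ {i = i} {j} t = toℕ-injective (≡ᵇ⇒≡ (toℕ i) (toℕ j) t)

≡⇒≡ᶠ : ∀ {m} {i j : Fin m} → i ≡ j → T (i ≡ᶠ j)
≡⇒≡ᶠ {i = i} refl = ≡⇒≡ᵇ (toℕ i) (toℕ i) refl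

Vec-ext : ∀ {A : Set} {n} {xs ys : Vec A n} → (∀ i → lookup xs i ≡ lookup ys i) → xs ≡ ys
Vec-ext {xs = xs} {ys} eq = trans (sym (tabulate∘lookup xs)) (trans (tabulate-cong eq) (tabulate∘lookup ys))

module _ {n m : ℕ} where

  ∈-block⁻ : ∀ (f : Vec (Fin m) n) {i v} → v ∈ block f i → lookup f v ≡ i
  ∈-block⁻ f {i} {v} v∈fi =
    ≡ᶠ⇒≡ (subst T (lookup∘tabulate (λ u → lookup f u ≡ᶠ i) v) (∈⇒lookup v∈fi))

  ∈-block⁺ : ∀ (f : Vec (Fin m) n) {i v} → lookup f v ≡ i → v ∈ block f i
  ∈-block⁺ f {i} {v} fv≡i =
    lookup⇒∈ (subst T (sym (lookup∘tabulate (λ u → lookup f u ≡ᶠ i) v)) (≡⇒≡ᶠ fv≡i))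

  record Canonical (f : Vec (Fin m) n) : Set where
    field
      surjective       : ∀ i → ∃ λ v → lookup f v ≡ i
      first-occurrence : ∀ v {j} → toℕ j < toℕ (lookup f v) →
                         ∃ λ u → toℕ u < toℕ v × lookup f u ≡ j

  canonical⇒Canonical : ∀ {f : Vec (Fin m) n} → T (canonical f) → Canonical f
  canonical⇒Canonical {f} t =
    let surj , first = T-∧⁻ (all (λ i → any (λ v → lookup f v ≡ᶠ i) (allFin n)) (allFin m)) t
    in record
      { surjective = λ i →
          let v , fv≡i = any⇒∃ ∈-allFin (all⇒∀ ∈-allFin surj i) in v , ≡ᶠ⇒≡ fv≡i
      ; first-occurrence = λ v {j} j<fv →
          let u , t = any⇒∃ ∈-allFin (T-→⁻ (all⇒∀ ∈-allFin (all⇒∀ ∈-allFin first v) j)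
                                          (<⇒<ᵇ j<fv))
              u<v , fu≡j = T-∧⁻ (toℕ u <ᵇ toℕ v) t
          in u , <ᵇ⇒< _ _ u<v , ≡ᶠ⇒≡ fu≡j
      }

  Canonical⇒canonical : ∀ {f : Vec (Fin m) n} → Canonical f → T (canonical f)
  Canonical⇒canonical {f} can = T-∧⁺
    (∀⇒all ∈-allFin λ i → let v , fv≡i = surjective i in ∃⇒any ∈-allFin v (≡⇒≡ᶠ fv≡i))
    (∀⇒all ∈-allFin λ v → ∀⇒all (∈-allFin {m}) λ j → T-→⁺ λ j<fv →
       let u , u<v , fu≡j = first-occurrence v (<ᵇ⇒< _ _ j<fv)
       in ∃⇒any ∈-allFin u (T-∧⁺ (<⇒<ᵇ u<v) (≡⇒≡ᶠ fu≡j)))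
    where open Canonical can

surjective-coarser⇒≤ : ∀ {n m m'} {f : Vec (Fin m) n} {f' : Vec (Fin m') n} →
                       (∀ i → ∃ λ v → lookup f v ≡ i) →
                       (∀ {u v} → lookup f' u ≡ lookup f' v → lookup f u ≡ lookup f v) → m ≤ m'
surjective-coarser⇒≤ {f = f} {f'} surjective coarser =
  injective⇒≤ {f = lookup f' ∘ representative} λ {i} {j} eq →
    trans (sym (proj₂ (surjective i))) (trans (coarser eq) (proj₂ (surjective j)))
  where
  representative = λ i → proj₁ (surjective i)

Canonical⇒≤ : ∀ {n m} {f : Vec (Fin m) n} → Canonical f → m ≤ n
Canonical⇒≤ {f = f} can = surjective-coarser⇒≤ {f = f} {tabulate (λ v → v)} (Canonical.surjective can)
  λ {u} {v} eq → cong (lookup f) (trans (sym (lookup∘tabulate _ u)) (trans eq (lookup∘tabulate _ v)))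

-- If f' v < f v, the first occurrence under f of the label f' v is at some u < v, and agreement at u
-- then puts u and v in one block of f' and hence of f.
canonical-label-≤ : ∀ {n m m'} {f : Vec (Fin m) n} {f' : Vec (Fin m') n} → Canonical f →
                    (∀ {u v} → lookup f' u ≡ lookup f' v → lookup f u ≡ lookup f v) →
                    ∀ v → (∀ {u} → toℕ u < toℕ v → toℕ (lookup f u) ≡ toℕ (lookup f' u)) →
                    toℕ (lookup f v) ≤ toℕ (lookup f' v)
canonical-label-≤ {f = f} {f'} can coarser v agree-below = ≮⇒≥ λ f'v<fv →
  let j<m = <-trans f'v<fv (toℕ<n (lookup f v))
      j≡f'v = toℕ-fromℕ< j<m
      u , u<v , fu≡j = Canonical.first-occurrence can v (subst (_< toℕ (lookup f v)) (sym j≡f'v) f'v<fv)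
      f'u≡f'v = toℕ-injective (trans (sym (agree-below u<v)) (trans (cong toℕ fu≡j) j≡f'v))
      fv≡f'v = trans (cong toℕ (sym (coarser f'u≡f'v))) (trans (cong toℕ fu≡j) j≡f'v)
  in <-irrefl (sym fv≡f'v) f'v<fv

canonical-unique : ∀ {n m m'} {f : Vec (Fin m) n} {f' : Vec (Fin m') n} → Canonical f → Canonical f' →
                   (∀ {u v} → lookup f u ≡ lookup f v → lookup f' u ≡ lookup f' v) →
                   (∀ {u v} → lookup f' u ≡ lookup f' v → lookup f u ≡ lookup f v) →
                   _≡_ {A = Σ ℕ λ k → Vec (Fin k) n} (m , f) (m' , f')
canonical-unique {f = f} {f'} can can' finer coarser
  with ≤-antisym (surjective-coarser⇒≤ {f = f} {f'} (Canonical.surjective can) coarser)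
                 (surjective-coarser⇒≤ {f = f'} {f} (Canonical.surjective can') finer)
... | refl = cong (_ ,_) (Vec-ext λ v → toℕ-injective (agree v (<-wellFounded v)))
  where
  agree : ∀ v → Acc _<ᶠ_ v → toℕ (lookup f v) ≡ toℕ (lookup f' v)
  agree v (acc below) = ≤-antisym (canonical-label-≤ {f = f} {f'} can coarser v IH)
                                  (canonical-label-≤ {f = f'} {f} can' finer v (sym ∘ IH))
    where
    IH : ∀ {u} → toℕ u < toℕ v → toℕ (lookup f u) ≡ toℕ (lookup f' u)
    IH u<v = agree _ (below u<v)

Canonical-map : ∀ {n m m'} {f : Vec (Fin m) n} {ρ : Fin m → Fin m'} (ρ⁻ : Fin m' → Fin m) →
                (∀ l → ρ (ρ⁻ l) ≡ l) → (∀ {k l} → toℕ l < toℕ (ρ k) → toℕ (ρ⁻ l) < toℕ k) →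
                Canonical f → Canonical (mapᵛ ρ f)
Canonical-map {f = f} {ρ} ρ⁻ section ρ⁻-below can = record
  { surjective = λ l →
      let v , fv≡ρ⁻l = surjective (ρ⁻ l) in v , ρ-label v fv≡ρ⁻l
  ; first-occurrence = λ v {l} l<ρfv →
      let u , u<v , fu≡ρ⁻l =
            first-occurrence v (ρ⁻-below (subst (λ k → toℕ l < toℕ k) (lookup-map v ρ f) l<ρfv))
      in u , u<v , ρ-label u fu≡ρ⁻l
  }
  where
  open Canonical can
  ρ-label : ∀ v {l} → lookup f v ≡ ρ⁻ l → lookup (mapᵛ ρ f) v ≡ l
  ρ-label v {l} fv≡ρ⁻l = trans (lookup-map v ρ f) (trans (cong ρ fv≡ρ⁻l) (section l))

-- Label J is sent to I, and the labels above J are shifted down to close the gap.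
module Merge {m : ℕ} {I J : Fin (suc m)} (I<J : I <ᶠ J) where

  redirect : Fin (suc m) → Fin (suc m)
  redirect k with k ≟ᶠ J
  ... | yes _ = I
  ... | no  _ = k

  redirect-≢J : ∀ {k} → k ≢ J → redirect k ≡ k
  redirect-≢J {k} k≢J with k ≟ᶠ J
  ... | yes k≡J = ⊥-elim (k≢J k≡J)
  ... | no  _   = refl

  redirect-IJ : ∀ {k} → k ≡ I ⊎ k ≡ J → redirect k ≡ I
  redirect-IJ (inj₁ refl) = redirect-≢J (<⇒≢ I<J)
  redirect-IJ {k} (inj₂ k≡J) with k ≟ᶠ J
  ... | yes _   = refl
  ... | no  k≢J = ⊥-elim (k≢J k≡J)

  redirect-collision : ∀ a b → redirect a ≡ redirect b →
                       a ≡ b ⊎ (a ≡ I ⊎ a ≡ J) × (b ≡ I ⊎ b ≡ J)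
  redirect-collision a b eq with a ≟ᶠ J | b ≟ᶠ J
  ... | yes a≡J | yes b≡J = inj₁ (trans a≡J (sym b≡J))
  ... | yes a≡J | no  _   = inj₂ (inj₂ a≡J , inj₁ (sym eq))
  ... | no  _   | yes b≡J = inj₂ (inj₁ eq , inj₂ b≡J)
  ... | no  _   | no  _   = inj₁ eq

  J≢redirect : ∀ k → J ≢ redirect k
  J≢redirect k with k ≟ᶠ J
  ... | yes _   = <⇒≢ I<J ∘ sym
  ... | no  k≢J = k≢J ∘ sym

  redirect≤ : ∀ k → toℕ (redirect k) ≤ toℕ k
  redirect≤ k with k ≟ᶠ J
  ... | yes refl = <⇒≤ I<J
  ... | no  _    = ≤-refl

  merge : Fin (suc m) → Fin m
  merge k = punchOut (J≢redirect k)

  merge-punchIn : ∀ l → merge (punchIn J l) ≡ l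
  merge-punchIn l = trans (punchOut-cong J (redirect-≢J (punchInᵢ≢i J l))) (punchOut-punchIn J)

  merge-below : ∀ {k l} → toℕ l < toℕ (merge k) → toℕ (punchIn J l) < toℕ k
  merge-below {k} {l} l<mk =
    <-≤-trans (subst (λ k′ → toℕ (punchIn J l) < toℕ k′) (punchIn-punchOut (J≢redirect k)) punchIn-l<)
              (redirect≤ k)
    where
    punchIn-l< : toℕ (punchIn J l) < toℕ (punchIn J (merge k))
    punchIn-l< = ≤∧≢⇒< (punchIn-mono-≤ J l (merge k) (<⇒≤ l<mk))
                       (λ eq → <⇒≢ l<mk (punchIn-injective J l (merge k) eq))

  merge≡⇒redirect≡ : ∀ a b → merge a ≡ merge b → redirect a ≡ redirect b
  merge≡⇒redirect≡ a b = punchOut-injective (J≢redirect a) (J≢redirect b)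

  redirect≡⇒merge≡ : ∀ a b → redirect a ≡ redirect b → merge a ≡ merge b
  redirect≡⇒merge≡ a b = punchOut-cong J

  module _ {n : ℕ} {f : Vec (Fin (suc m)) n} where

    Canonical-merge : Canonical f → Canonical (mapᵛ merge f)
    Canonical-merge = Canonical-map (punchIn J) merge-punchIn merge-below

    merged-kernel : ∀ {u v} → lookup (mapᵛ merge f) u ≡ lookup (mapᵛ merge f) v →
                    redirect (lookup f u) ≡ redirect (lookup f v)
    merged-kernel {u} {v} eq = merge≡⇒redirect≡ (lookup f u) (lookup f v)
      (trans (sym (lookup-map u merge f)) (trans eq (lookup-map v merge f)))

    ∈-merged-block⁻ : ∀ {l v} → v ∈ block (mapᵛ merge f) l →
                      redirect (lookup f v) ≡ redirect (punchIn J l)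
    ∈-merged-block⁻ {l} {v} v∈ = merge≡⇒redirect≡ (lookup f v) (punchIn J l)
      (trans (sym (lookup-map v merge f)) (trans (∈-block⁻ (mapᵛ merge f) v∈) (sym (merge-punchIn l))))

    ∈-merged-block⁺ : ∀ {l v} → redirect (lookup f v) ≡ redirect (punchIn J l) →
                      v ∈ block (mapᵛ merge f) l
    ∈-merged-block⁺ {l} {v} eq = ∈-block⁺ (mapᵛ merge f)
      (trans (lookup-map v merge f) (trans (redirect≡⇒merge≡ (lookup f v) (punchIn J l) eq) (merge-punchIn l)))

    merged-block-I : ∀ {l} → punchIn J l ≡ I → block (mapᵛ merge f) l ≡ block f I ∪ block f J
    merged-block-I {l} k≡I = ⊆-antisym
      (λ {v} v∈ → x∈p∪q⁺ (Sum.map (∈-block⁺ f) (∈-block⁺ f)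
        (in-IJ (redirect-collision (lookup f v) I (trans (∈-merged-block⁻ v∈) (cong redirect k≡I))))))
      (λ v∈ → ∈-merged-block⁺ (trans (redirect-IJ (Sum.map (∈-block⁻ f) (∈-block⁻ f) (x∈p∪q⁻ _ _ v∈)))
                                     (sym (trans (cong redirect k≡I) (redirect-IJ (inj₁ refl))))))
      where
      in-IJ : ∀ {a} → a ≡ I ⊎ (a ≡ I ⊎ a ≡ J) × (I ≡ I ⊎ I ≡ J) → a ≡ I ⊎ a ≡ J
      in-IJ (inj₁ a≡I)        = inj₁ a≡I
      in-IJ (inj₂ (a∈IJ , _)) = a∈IJ

    merged-block-other : ∀ {l} → punchIn J l ≢ I → block (mapᵛ merge f) l ≡ block f (punchIn J l)
    merged-block-other {l} k≢I = ⊆-antisym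
      (λ {v} v∈ → ∈-block⁺ f (same-label (redirect-collision (lookup f v) (punchIn J l) (∈-merged-block⁻ v∈))))
      (λ v∈ → ∈-merged-block⁺ (cong redirect (∈-block⁻ f v∈)))
      where
      same-label : ∀ {a} → a ≡ punchIn J l ⊎ (a ≡ I ⊎ a ≡ J) × (punchIn J l ≡ I ⊎ punchIn J l ≡ J) →
                   a ≡ punchIn J l
      same-label (inj₁ a≡k)             = a≡k
      same-label (inj₂ (_ , inj₁ k≡I)) = ⊥-elim (k≢I k≡I)
      same-label (inj₂ (_ , inj₂ k≡J)) = ⊥-elim (punchInᵢ≢i J l k≡J)

-- the predicate counted by `chromaticPoly`
properᵇ : ∀ {m r} → (Fin m → Fin m → Bool) → Vec (Fin r) m → Bool
properᵇ {m} adj c =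
  all (λ i → all (λ j → not (adj i j) ∨ not (lookup c i ≡ᶠ lookup c j)) (allFin m)) (allFin m)

Proper : ∀ {m r} → (Fin m → Fin m → Bool) → Vec (Fin r) m → Set
Proper adj c = ∀ i j → T (adj i j) → lookup c i ≢ lookup c j

module _ {m r : ℕ} {adj : Fin m → Fin m → Bool} {c : Vec (Fin r) m} where

  properᵇ⇒Proper : T (properᵇ adj c) → Proper adj c
  properᵇ⇒Proper t i j ij ci≡cj =
    T-not⁻ (T-→⁻ (all⇒∀ ∈-allFin (all⇒∀ ∈-allFin t i) j) ij) (≡⇒≡ᶠ ci≡cj)

  Proper⇒properᵇ : Proper adj c → T (properᵇ adj c)
  Proper⇒properᵇ proper = ∀⇒all ∈-allFin λ i → ∀⇒all (∈-allFin {m}) λ j →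
    T-→⁺ λ ij → T-not⁺ λ t → proper i j ij (≡ᶠ⇒≡ t)

module _ {n : ℕ} (K : SimplicialComplex n) (s : ℕ) where

  IsSimplex : Subset n → Set
  IsSimplex σ = T (isSimplex K s σ)

  Monochromatic : ∀ {r} → Vec (Fin r) n → Subset n → Set
  Monochromatic x σ = ∃ λ k → ∀ {v} → v ∈ σ → lookup x v ≡ k

  Coloring : ∀ {r} → Vec (Fin r) n → Set
  Coloring x = ∀ {σ} → IsSimplex σ → ¬ Monochromatic x σ

  Independent : Subset n → Set
  Independent B = ∀ {σ} → IsSimplex σ → ¬ σ ⊆ B

  record BlockConnectedPartition {m} (f : Vec (Fin m) n) : Set where
    field
      is-canonical       : Canonical f
      blocks-connected   : ∀ i → Connected K (block f i)
      blocks-independent : ∀ i → Independent (block f i)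

  simplex-face : ∀ {σ} → IsSimplex σ → IsFace K σ
  simplex-face {σ} t = proj₁ (T-∧⁻ (face K σ) t)

  simplex-size : ∀ {σ} → IsSimplex σ → ∣ σ ∣ ≡ suc s
  simplex-size {σ} t = ≡ᵇ⇒≡ ∣ σ ∣ (suc s) (proj₂ (T-∧⁻ (face K σ) t))

  simplex-nonempty : ∀ {σ} → IsSimplex σ → Nonempty σ
  simplex-nonempty {σ} t with nonempty? σ
  ... | yes σ≢∅ = σ≢∅
  ... | no  σ≡∅ = ⊥-elim (0≢1+n (begin
    0         ≡⟨ ∣⊥∣≡0 n ⟨
    ∣ ⊥ˢ {n} ∣ ≡⟨ cong ∣_∣ (Empty-unique σ≡∅) ⟨
    ∣ σ ∣     ≡⟨ simplex-size t ⟩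
    suc s     ∎))
    where open ≡-Reasoning

  module _ {r : ℕ} {x : Vec (Fin r) n} where

    monochrome⇒Monochromatic : ∀ {σ} → T (monochrome K s x σ) → Monochromatic x σ
    monochrome⇒Monochromatic t =
      let k , t = any⇒∃ ∈-allFin t
      in k , λ {v} v∈σ → ≡ᶠ⇒≡ (T-→⁻ (all⇒∀ ∈-allFin t v) (∈⇒lookup v∈σ))

    Monochromatic⇒monochrome : ∀ {σ} → Monochromatic x σ → T (monochrome K s x σ)
    Monochromatic⇒monochrome (k , mono) =
      ∃⇒any ∈-allFin k (∀⇒all ∈-allFin λ v → T-→⁺ λ v∈σ → ≡⇒≡ᶠ (mono (lookup⇒∈ {v = v} v∈σ)))

    isColoring⇒Coloring : T (isColoring K s x) → Coloring x
    isColoring⇒Coloring t {σ} simplex mono =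
      T-not⁻ t (∃⇒any ∈-allSubsets σ (T-∧⁺ simplex (Monochromatic⇒monochrome mono)))

    Coloring⇒isColoring : Coloring x → T (isColoring K s x)
    Coloring⇒isColoring coloring = T-not⁺ λ t →
      let σ , t = any⇒∃ ∈-allSubsets t
          simplex , mono = T-∧⁻ (isSimplex K s σ) t
      in coloring simplex (monochrome⇒Monochromatic mono)

  independent⇒Independent : ∀ {B} → T (independent K s B) → Independent B
  independent⇒Independent t {σ} simplex σ⊆B =
    T-not⁻ t (∃⇒any ∈-allSubsets σ (T-∧⁺ simplex (⊆⇒⊆ᵇ σ⊆B)))

  Independent⇒independent : ∀ {B} → Independent B → T (independent K s B)
  Independent⇒independent indep = T-not⁺ λ t →
    let σ , t = any⇒∃ ∈-allSubsets t
        simplex , σ⊆B = T-∧⁻ (isSimplex K s σ) t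
    in indep simplex (⊆ᵇ⇒⊆ σ⊆B)

  module _ {m : ℕ} {f : Vec (Fin m) n} where

    inBCP⇒BlockConnectedPartition : T (inBCP K s f) → BlockConnectedPartition f
    inBCP⇒BlockConnectedPartition t =
      let can , blocks = T-∧⁻ (canonical f) t
          block-ok = λ i → T-∧⁻ (connected K (block f i)) (all⇒∀ ∈-allFin blocks i)
      in record
        { is-canonical       = canonical⇒Canonical can
        ; blocks-connected   = λ i → connected⇒Connected K (proj₁ (block-ok i))
        ; blocks-independent = λ i → independent⇒Independent (proj₂ (block-ok i))
        }

    BlockConnectedPartition⇒inBCP : BlockConnectedPartition f → T (inBCP K s f)
    BlockConnectedPartition⇒inBCP bcp = T-∧⁺ (Canonical⇒canonical is-canonical) (∀⇒all ∈-allFin λ i →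
      T-∧⁺ (Connected⇒connected K (blocks-connected i)) (Independent⇒independent (blocks-independent i)))
      where open BlockConnectedPartition bcp

    G₀⇒ : ∀ {i j} → T (G₀ K f i j) → i ≢ j × Connected K (block f i ∪ block f j)
    G₀⇒ {i} {j} t =
      let i≢j , conn = T-∧⁻ (not (i ≡ᶠ j)) t
      in (λ i≡j → T-not⁻ i≢j (≡⇒≡ᶠ i≡j)) , connected⇒Connected K conn

    ⇒G₀ : ∀ {i j} → i ≢ j → Connected K (block f i ∪ block f j) → T (G₀ K f i j)
    ⇒G₀ i≢j conn = T-∧⁺ (T-not⁺ (i≢j ∘ ≡ᶠ⇒≡)) (Connected⇒connected K conn)

-- Colorings correspond to proper colorings of partition graphs

module _ {n : ℕ} (K : SimplicialComplex n) (s : ℕ) {r : ℕ} where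

  record Decomposition (x : Vec (Fin r) n) {m} (f : Vec (Fin m) n) (c : Vec (Fin r) m) : Set where
    field
      bcp     : BlockConnectedPartition K s f
      proper  : Proper (G₀ K f) c
      factors : ∀ v → lookup x v ≡ lookup c (lookup f v)

  module _ {x : Vec (Fin r) n} {m} {f : Vec (Fin m) n} {c : Vec (Fin r) m} (dec : Decomposition x f c) where
    open Decomposition dec
    open BlockConnectedPartition bcp

    adjacent-blocks : ∀ {σ a b} → IsFace K σ → a ∈ σ → b ∈ σ → lookup f a ≢ lookup f b →
                      T (G₀ K f (lookup f a) (lookup f b))
    adjacent-blocks σ-face a∈σ b∈σ fa≢fb = ⇒G₀ K s {f = f} fa≢fb (Connected-∪ K
      (blocks-connected _) (blocks-connected _) σ-face a∈σ b∈σ (∈-block⁺ f refl) (∈-block⁺ f refl))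

    same-color⇒same-block : ∀ {σ a b} → IsFace K σ → a ∈ σ → b ∈ σ →
                            lookup x a ≡ lookup x b → lookup f a ≡ lookup f b
    same-color⇒same-block {a = a} {b} σ-face a∈σ b∈σ xa≡xb with lookup f a ≟ᶠ lookup f b
    ... | yes fa≡fb = fa≡fb
    ... | no  fa≢fb = ⊥-elim (proper _ _ (adjacent-blocks σ-face a∈σ b∈σ fa≢fb)
                                         (trans (sym (factors a)) (trans xa≡xb (factors b))))

    Decomposition⇒Coloring : Coloring K s x
    Decomposition⇒Coloring {σ} simplex (k , mono) =
      let v , v∈σ = simplex-nonempty K s simplex
      in blocks-independent (lookup f v) simplex λ a∈σ → ∈-block⁺ f
           (same-color⇒same-block (simplex-face K s simplex) a∈σ v∈σ (trans (mono a∈σ) (sym (mono v∈σ))))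

  -- A face crossing a cut of a block of f through f' would join two adjacent f'-blocks of equal color.
  decomposition-finer : ∀ {x : Vec (Fin r) n} {m m'} {f : Vec (Fin m) n} {f' : Vec (Fin m') n} {c c'} →
                        Decomposition x f c → Decomposition x f' c' →
                        ∀ {u v} → lookup f u ≡ lookup f v → lookup f' u ≡ lookup f' v
  decomposition-finer {f = f} {f'} {c} dec dec' {u} {v} fu≡fv with lookup f' u ≟ᶠ lookup f' v
  ... | yes f'u≡f'v = f'u≡f'v
  ... | no  f'u≢f'v =
    let σ , σ-face , σ⊆B , (a , a∈σ∩S) , (b , b∈σ∖S) = crossing-face K (blocks-connected _) S⊆B u∈S v∈B∖S
        a∈σ , a∈S  = x∈p∩q⁻ σ S a∈σ∩S
        b∈σ , b∈∁S = x∈p∩q⁻ σ (∁ S) b∈σ∖S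
        fa≡fb = trans (∈-block⁻ f (σ⊆B a∈σ)) (sym (∈-block⁻ f (σ⊆B b∈σ)))
        xa≡xb = trans (factors a) (trans (cong (lookup c) fa≡fb) (sym (factors b)))
        f'b≡f'u = trans (sym (same-color⇒same-block dec' σ-face a∈σ b∈σ xa≡xb)) (∈-block⁻ f' (p∩q⊆q B _ a∈S))
    in ⊥-elim (x∈∁p⇒x∉p b∈∁S (x∈p∩q⁺ (σ⊆B b∈σ , ∈-block⁺ f' f'b≡f'u)))
    where
    open Decomposition dec
    open BlockConnectedPartition bcp
    B = block f (lookup f u)
    S = B ∩ block f' (lookup f' u)
    S⊆B : S ⊆ B
    S⊆B = p∩q⊆p B _
    u∈S : Nonempty S
    u∈S = u , x∈p∩q⁺ (∈-block⁺ f refl , ∈-block⁺ f' refl)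
    v∈B∖S : Nonempty (B ∩ ∁ S)
    v∈B∖S = v , x∈p∩q⁺ (∈-block⁺ f (sym fu≡fv) ,
                        x∉p⇒x∈∁p λ v∈S → f'u≢f'v (sym (∈-block⁻ f' (p∩q⊆q B _ v∈S))))

  decomposition-unique : ∀ {x : Vec (Fin r) n} {m m'} {f : Vec (Fin m) n} {f' : Vec (Fin m') n} {c c'} →
                         Decomposition x f c → Decomposition x f' c' →
                         _≡_ {A = Σ ℕ λ k → Vec (Fin k) n × Vec (Fin r) k} (m , f , c) (m' , f' , c')
  decomposition-unique {x} {f = f} {f'} {c} {c'} dec dec'
    with canonical-unique (BlockConnectedPartition.is-canonical (Decomposition.bcp dec))
                          (BlockConnectedPartition.is-canonical (Decomposition.bcp dec'))
                          (decomposition-finer dec dec') (decomposition-finer dec' dec)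
  ... | refl = cong (λ c → _ , f , c) (Vec-ext λ i →
    let v , fv≡i = Canonical.surjective (is-canonical (bcp dec)) i
    in begin
      lookup c i                  ≡⟨ cong (lookup c) fv≡i ⟨
      lookup c (lookup f v)       ≡⟨ factors dec v ⟨
      lookup x v                  ≡⟨ factors dec' v ⟩
      lookup c' (lookup f v)      ≡⟨ cong (lookup c') fv≡i ⟩
      lookup c' i                 ∎)
    where
    open Decomposition
    open BlockConnectedPartition
    open ≡-Reasoning

  decomposition-unique-labels : ∀ {m} {x : Vec (Fin r) n} {f f₀ : Vec (Fin m) n} {c c₀} →
                                Decomposition x f c → Decomposition x f₀ c₀ → f ≡ f₀ × c ≡ c₀
  decomposition-unique-labels dec dec₀ with decomposition-unique dec dec₀
  ... | refl = refl , refl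

  record ConnectedRefinement (x : Vec (Fin r) n) {m} (f : Vec (Fin m) n) : Set where
    field
      is-canonical     : Canonical f
      blocks-connected : ∀ i → Connected K (block f i)
      constant         : ∀ {u v} → lookup f u ≡ lookup f v → lookup x u ≡ lookup x v

  singletons : ∀ {x} → ConnectedRefinement x (tabulate (λ v → v))
  singletons {x} = record
    { is-canonical = record
        { surjective       = λ i → i , id-label i
        ; first-occurrence = λ v {j} j<v → j , subst (λ w → toℕ j < toℕ w) (id-label v) j<v , id-label j
        }
    ; blocks-connected = λ i → subst (Connected K) (sym (block-singleton i)) (Connected-⁅⁆ K i)
    ; constant         = λ {u} {v} eq → cong (lookup x) (trans (sym (id-label u)) (trans eq (id-label v)))
    }
    where
    id : Vec (Fin n) n
    id = tabulate (λ v → v)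
    id-label : ∀ v → lookup id v ≡ v
    id-label = lookup∘tabulate (λ v → v)
    block-singleton : ∀ i → block id i ≡ ⁅ i ⁆
    block-singleton i = ⊆-antisym
      (λ {v} v∈ → subst (_∈ ⁅ i ⁆) (trans (sym (∈-block⁻ id v∈)) (id-label v)) (x∈⁅x⁆ i))
      (λ {v} v∈ → ∈-block⁺ id (trans (id-label v) (x∈⁅y⁆⇒x≡y i v∈)))

  module _ {x : Vec (Fin r) n} {m} {f : Vec (Fin (suc m)) n} {I J : Fin (suc m)} (I<J : I <ᶠ J) where
    open Merge I<J

    merge-refinement : ConnectedRefinement x f → Connected K (block f I ∪ block f J) →
                       (∀ {u v} → lookup f u ≡ I → lookup f v ≡ J → lookup x u ≡ lookup x v) →
                       ConnectedRefinement x (mapᵛ merge f)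
    merge-refinement ref IJ-connected IJ-same-color = record
      { is-canonical     = Canonical-merge is-canonical
      ; blocks-connected = merged-connected
      ; constant         = λ {u} {v} eq →
          by-collision (redirect-collision (lookup f u) (lookup f v) (merged-kernel {f = f} eq))
      }
      where
      open ConnectedRefinement ref

      merged-connected : ∀ l → Connected K (block (mapᵛ merge f) l)
      merged-connected l with punchIn J l ≟ᶠ I
      ... | yes k≡I = subst (Connected K) (sym (merged-block-I {f = f} k≡I)) IJ-connected
      ... | no  k≢I = subst (Connected K) (sym (merged-block-other {f = f} k≢I)) (blocks-connected _)

      by-collision : ∀ {u v} → lookup f u ≡ lookup f v ⊎
                               (lookup f u ≡ I ⊎ lookup f u ≡ J) × (lookup f v ≡ I ⊎ lookup f v ≡ J) →
                     lookup x u ≡ lookup x v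
      by-collision (inj₁ fu≡fv)                   = constant fu≡fv
      by-collision (inj₂ (inj₁ fu≡I , inj₁ fv≡I)) = constant (trans fu≡I (sym fv≡I))
      by-collision (inj₂ (inj₁ fu≡I , inj₂ fv≡J)) = IJ-same-color fu≡I fv≡J
      by-collision (inj₂ (inj₂ fu≡J , inj₁ fv≡I)) = sym (IJ-same-color fv≡I fu≡J)
      by-collision (inj₂ (inj₂ fu≡J , inj₂ fv≡J)) = constant (trans fu≡J (sym fv≡J))

  module _ {x : Vec (Fin r) n} {m} {f : Vec (Fin m) n} (ref : ConnectedRefinement x f) where
    open ConnectedRefinement ref

    block-colors : Vec (Fin r) m
    block-colors = tabulate λ i → lookup x (proj₁ (Canonical.surjective is-canonical i))

    block-colors-factor : ∀ v → lookup x v ≡ lookup block-colors (lookup f v)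
    block-colors-factor v = sym (trans (lookup∘tabulate _ (lookup f v))
                                       (constant (proj₂ (Canonical.surjective is-canonical (lookup f v)))))

    equal-block-colors : ∀ {i j} → lookup block-colors i ≡ lookup block-colors j →
                         ∀ {u v} → lookup f u ≡ i → lookup f v ≡ j → lookup x u ≡ lookup x v
    equal-block-colors ci≡cj {u} {v} refl refl =
      trans (block-colors-factor u) (trans ci≡cj (sym (block-colors-factor v)))

    refinement-decomposition : Coloring K s x → Proper (G₀ K f) block-colors → Decomposition x f block-colors
    refinement-decomposition coloring proper = record
      { bcp = record
          { is-canonical       = is-canonical
          ; blocks-connected   = blocks-connected
          ; blocks-independent = λ i simplex σ⊆fi → coloring simplex (lookup block-colors i , λ v∈σ →
              trans (block-colors-factor _) (cong (lookup block-colors) (∈-block⁻ f (σ⊆fi v∈σ))))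
          }
      ; proper  = proper
      ; factors = block-colors-factor
      }

  -- Merge two adjacent blocks of equal color until the coloring of the blocks is proper.
  refinement⇒decomposition : ∀ {x : Vec (Fin r) n} → Coloring K s x → ∀ {m} {f : Vec (Fin m) n} →
                             ConnectedRefinement x f →
                             ∃ λ m' → ∃ λ (f' : Vec (Fin m') n) → ∃ (Decomposition x f')
  refinement⇒decomposition coloring {zero} ref = _ , _ , _ , refinement-decomposition ref coloring λ ()
  refinement⇒decomposition coloring {suc m} {f} ref
    with any? (λ i → any? λ j → T? (G₀ K f i j) ×-dec
                                  (lookup (block-colors ref) i ≟ᶠ lookup (block-colors ref) j))
  ... | no ¬conflict =
    _ , _ , _ , refinement-decomposition ref coloring λ i j ij ci≡cj → ¬conflict (i , j , ij , ci≡cj)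
  ... | yes (i , j , ij , ci≡cj) with G₀⇒ K s {f = f} ij | <-cmp i j
  ...   | _   , conn | tri< i<j _ _ = refinement⇒decomposition coloring
          (merge-refinement i<j ref conn (equal-block-colors ref ci≡cj))
  ...   | i≢j , _    | tri≈ _ i≡j _ = ⊥-elim (i≢j i≡j)
  ...   | _   , conn | tri> _ _ j<i = refinement⇒decomposition coloring
          (merge-refinement j<i ref (subst (Connected K) (∪-comm _ _) conn) (equal-block-colors ref (sym ci≡cj)))

  Coloring⇒Decomposition : ∀ {x : Vec (Fin r) n} → Coloring K s x →
                           ∃ λ m → ∃ λ (f : Vec (Fin m) n) → ∃ (Decomposition x f)
  Coloring⇒Decomposition coloring = refinement⇒decomposition coloring singletons

private
  variable
    A B : Set

∑ : List A → (A → ℕ) → ℕ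
∑ xs g = sum (map g xs)

syntax ∑ xs (λ x → e) = ∑[ x ← xs ] e

indicator : Bool → ℕ
indicator true  = 1
indicator false = 0

indicator-true : ∀ {b} → T b → indicator b ≡ 1
indicator-true {true} _ = refl

indicator-false : ∀ {b} → ¬ T b → indicator b ≡ 0
indicator-false {true}  ¬b = ⊥-elim (¬b _)
indicator-false {false} _  = refl

count≡∑ : ∀ (p : A → Bool) xs → count p xs ≡ ∑[ x ← xs ] indicator (p x)
count≡∑ p []       = refl
count≡∑ p (x ∷ xs) with p x
... | true  = cong suc (count≡∑ p xs)
... | false = count≡∑ p xs

∑-cong : ∀ (xs : List A) {g h : A → ℕ} → (∀ x → g x ≡ h x) → ∑ xs g ≡ ∑ xs h
∑-cong xs g≗h = cong sum (map-cong g≗h xs)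

∑-zero : ∀ (xs : List A) {g : A → ℕ} → (∀ x → g x ≡ 0) → ∑ xs g ≡ 0
∑-zero []       g≡0 = refl
∑-zero (x ∷ xs) g≡0 = cong₂ _+_ (g≡0 x) (∑-zero xs g≡0)

∑-+ : ∀ (xs : List A) (g h : A → ℕ) → ∑[ x ← xs ] (g x + h x) ≡ ∑ xs g + ∑ xs h
∑-+ []       g h = refl
∑-+ (x ∷ xs) g h = trans (cong (g x + h x +_) (∑-+ xs g h)) (+-interchange (g x) (h x) _ _)

∑-comm : ∀ (xs : List A) (ys : List B) (g : A → B → ℕ) →
         ∑[ x ← xs ] ∑[ y ← ys ] g x y ≡ ∑[ y ← ys ] ∑[ x ← xs ] g x y
∑-comm xs []       g = ∑-zero xs λ _ → refl
∑-comm xs (y ∷ ys) g =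
  trans (∑-+ xs (λ x → g x y) _) (cong (∑[ x ← xs ] g x y +_) (∑-comm xs ys g))

∑-term≤ : ∀ {xs : List A} {x} (g : A → ℕ) → x ∈ˡ xs → g x ≤ ∑ xs g
∑-term≤ {xs = y ∷ ys} g (here refl) = m≤m+n (g y) _
∑-term≤ {xs = y ∷ ys} g (there x∈) = ≤-trans (∑-term≤ g x∈) (m≤n+m _ (g y))

∑-positive : ∀ (xs : List A) {g : A → ℕ} → 0 < ∑ xs g → ∃ λ x → x ∈ˡ xs × 0 < g x
∑-positive (x ∷ xs) {g} pos with g x in gx
... | suc _ = x , here refl , subst (0 <_) (sym gx) (s≤s z≤n)
... | zero  = let y , y∈ , gy>0 = ∑-positive xs pos in y , there y∈ , gy>0

∑-supported : ∀ {xs : List A} {x₀} (g : A → ℕ) → Unique xs → x₀ ∈ˡ xs →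
              (∀ x → x ≢ x₀ → g x ≡ 0) → ∑ xs g ≡ g x₀
∑-supported {xs = x₀ ∷ xs} g (x₀∉xs ∷ _) (here refl) g≡0 =
  trans (cong (g x₀ +_) (∑-zero-on xs x₀∉xs)) (+-identityʳ (g x₀))
  where
  ∑-zero-on : ∀ ys → All (x₀ ≢_) ys → ∑ ys g ≡ 0
  ∑-zero-on []       []          = refl
  ∑-zero-on (y ∷ ys) (x₀≢y ∷ ne) = cong₂ _+_ (g≡0 y (x₀≢y ∘ sym)) (∑-zero-on ys ne)
∑-supported {xs = y ∷ xs} g (y∉xs ∷ unique) (there x₀∈) g≡0 =
  cong₂ _+_ (g≡0 y λ { refl → All.lookup y∉xs x₀∈ refl }) (∑-supported g unique x₀∈ g≡0)

∑-filter-count : ∀ (p : A → Bool) (q : A → B → Bool) (xs : List A) (ys : List B) →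
                 ∑[ x ← filterᵇ p xs ] count (q x) ys ≡ ∑[ x ← xs ] ∑[ y ← ys ] indicator (p x ∧ q x y)
∑-filter-count p q []       ys = refl
∑-filter-count p q (x ∷ xs) ys with p x
... | true  = cong₂ _+_ (count≡∑ (q x) ys) (∑-filter-count p q xs ys)
... | false = cong₂ _+_ (sym (∑-zero ys λ _ → refl)) (∑-filter-count p q xs ys)

indicator-fibres : ∀ (_≟_ : DecidableEquality A) {xs : List A} → Unique xs → (∀ x → x ∈ˡ xs) →
                   ∀ b y → indicator b ≡ ∑[ x ← xs ] indicator (b ∧ isYes (x ≟ y))
indicator-fibres _≟_ {xs} unique complete false y = sym (∑-zero xs λ _ → refl)
indicator-fibres _≟_ {xs} unique complete true  y = sym (trans
  (∑-supported (λ x → indicator (isYes (x ≟ y))) unique (complete y)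
     λ x x≢y → indicator-false (x≢y ∘ toWitness {a? = x ≟ y}))
  (indicator-true (fromWitness {a? = y ≟ y} refl)))

least-positive : (F : ℕ → ℕ) → ∀ N → 0 < F N → ∃ λ k → 0 < F k × (∀ j → j < k → F j ≡ 0)
least-positive F zero    pos = zero , pos , λ _ ()
least-positive F (suc N) pos with F zero in F0≡
... | suc _ = zero , subst (0 <_) (sym F0≡) (s≤s z≤n) , λ _ ()
... | zero  =
  let k , Fk>0 , below = least-positive (F ∘ suc) N pos
  in suc k , Fk>0 , λ { zero _ → F0≡ ; (suc j) (s≤s j<k) → below j j<k }

IsLeastColors-exists : (F : ℕ → ℕ) → ∀ N → 0 < F (suc N) → ∃ (IsLeastColors F)
IsLeastColors-exists F N pos =
  let k , Fk>0 , below = least-positive (F ∘ suc) N pos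
  in suc k , s≤s z≤n , Fk>0 , λ { zero () ; (suc r) _ (s≤s r<k) → below r r<k }

IsLeastColors-of-sum : ∀ {I : Set} {F : ℕ → ℕ} (g : I → ℕ → ℕ) →
                       (∀ i r → g i r ≤ F r) → (∀ r → 0 < F r → ∃ λ i → 0 < g i r) →
                       ∀ {k} → IsLeastColors F k →
                       (∃ λ i → IsLeastColors (g i) k) × (∀ i k′ → IsLeastColors (g i) k′ → k ≤ k′)
IsLeastColors-of-sum g g≤F F>0⇒g>0 {k} (1≤k , Fk>0 , F-below) =
  (let i , gik>0 = F>0⇒g>0 k Fk>0 in i , 1≤k , gik>0 , λ r 1≤r r<k → n≤0⇒n≡0 (g-below i r 1≤r r<k)) ,
  λ i k′ (1≤k′ , gik′>0 , _) → ≮⇒≥ λ k′<k → 1≰0 (≤-trans gik′>0 (g-below i k′ 1≤k′ k′<k))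
  where
  g-below : ∀ i r → 1 ≤ r → r < k → g i r ≤ 0
  g-below i r 1≤r r<k = ≤-trans (g≤F i r) (≤-reflexive (F-below r 1≤r r<k))
  1≰0 : ¬ 1 ≤ 0
  1≰0 ()

-- Counting colorings through their decompositions

module _ {n : ℕ} (K : SimplicialComplex n) (s : ℕ) where

  decomposesᵇ : ∀ {r} → Vec (Fin r) n → ∀ {m} → Vec (Fin m) n → Vec (Fin r) m → Bool
  decomposesᵇ x f c = (inBCP K s f ∧ properᵇ (G₀ K f) c) ∧ isYes (≡-dec _≟ᶠ_ x (mapᵛ (lookup c) f))

  module _ {r m} {x : Vec (Fin r) n} {f : Vec (Fin m) n} {c : Vec (Fin r) m} where

    decomposesᵇ⇒Decomposition : T (decomposesᵇ x f c) → Decomposition K s x f c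
    decomposesᵇ⇒Decomposition t =
      let bcp-proper , x≡cf = T-∧⁻ (inBCP K s f ∧ properᵇ (G₀ K f) c) t
          bcp , proper      = T-∧⁻ (inBCP K s f) bcp-proper
      in record
        { bcp     = inBCP⇒BlockConnectedPartition K s bcp
        ; proper  = properᵇ⇒Proper {c = c} proper
        ; factors = λ v → trans (cong (λ y → lookup y v) (toWitness x≡cf)) (lookup-map v (lookup c) f)
        }

    Decomposition⇒decomposesᵇ : Decomposition K s x f c → T (decomposesᵇ x f c)
    Decomposition⇒decomposesᵇ dec =
      T-∧⁺ (T-∧⁺ (BlockConnectedPartition⇒inBCP K s bcp) (Proper⇒properᵇ {c = c} proper))
           (fromWitness (Vec-ext λ v → trans (factors v) (sym (lookup-map v (lookup c) f))))
      where open Decomposition dec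

  decompositions : ∀ {r} → Vec (Fin r) n → ℕ
  decompositions {r} x =
    ∑[ m ← upTo (suc n) ] ∑[ f ← allFinVecs m n ] ∑[ c ← allFinVecs r m ] indicator (decomposesᵇ x f c)

  bcpSum≡∑decompositions : ∀ r → bcpSum K s r ≡ ∑[ x ← allFinVecs r n ] decompositions x
  bcpSum≡∑decompositions r = begin
    bcpSum K s r
      ≡⟨ ∑-cong M (λ m → ∑-filter-count (inBCP K s) (λ f → properᵇ (G₀ K f)) (F m) (C m)) ⟩
    ∑[ m ← M ] ∑[ f ← F m ] ∑[ c ← C m ] indicator (inBCP K s f ∧ properᵇ (G₀ K f) c)
      ≡⟨ ∑-cong M (λ m → ∑-cong (F m) λ f → ∑-cong (C m) λ c →
           indicator-fibres (≡-dec _≟ᶠ_) (allFinVecs⁺ r n) ∈-allFinVecs _ (mapᵛ (lookup c) f)) ⟩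
    ∑[ m ← M ] ∑[ f ← F m ] ∑[ c ← C m ] ∑[ x ← X ] indicator (decomposesᵇ x f c)
      ≡⟨ ∑-cong M (λ m → ∑-cong (F m) λ f → ∑-comm (C m) X _) ⟩
    ∑[ m ← M ] ∑[ f ← F m ] ∑[ x ← X ] ∑[ c ← C m ] indicator (decomposesᵇ x f c)
      ≡⟨ ∑-cong M (λ m → ∑-comm (F m) X _) ⟩
    ∑[ m ← M ] ∑[ x ← X ] ∑[ f ← F m ] ∑[ c ← C m ] indicator (decomposesᵇ x f c)
      ≡⟨ ∑-comm M X _ ⟩
    ∑[ x ← X ] decompositions x ∎
    where
    open ≡-Reasoning
    M = upTo (suc n)
    X = allFinVecs r n
    F = λ m → allFinVecs m n
    C = λ m → allFinVecs r m

  decompositions-of-coloring : ∀ {r} {x : Vec (Fin r) n} → Coloring K s x → decompositions x ≡ 1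
  decompositions-of-coloring {r} {x} coloring with Coloring⇒Decomposition K s coloring
  ... | m₀ , f₀ , c₀ , dec₀ = begin
    decompositions x
      ≡⟨ ∑-supported _ (upTo⁺ (suc n)) (∈-upTo⁺ (s≤s m₀≤n)) (λ m m≢m₀ →
           ∑-zero (allFinVecs m n) λ f → ∑-zero (allFinVecs r m) λ c → indicator-false λ t →
             m≢m₀ (cong proj₁ (decomposition-unique K s (decomposition f c t) dec₀))) ⟩
    ∑[ f ← allFinVecs m₀ n ] ∑[ c ← allFinVecs r m₀ ] indicator (decomposesᵇ x f c)
      ≡⟨ ∑-supported _ (allFinVecs⁺ m₀ n) (∈-allFinVecs f₀) (λ f f≢f₀ →
           ∑-zero (allFinVecs r m₀) λ c → indicator-false λ t →
             f≢f₀ (proj₁ (decomposition-unique-labels K s (decomposition f c t) dec₀))) ⟩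
    ∑[ c ← allFinVecs r m₀ ] indicator (decomposesᵇ x f₀ c)
      ≡⟨ ∑-supported _ (allFinVecs⁺ r m₀) (∈-allFinVecs c₀) (λ c c≢c₀ → indicator-false λ t →
           c≢c₀ (proj₂ (decomposition-unique-labels K s (decomposition f₀ c t) dec₀))) ⟩
    indicator (decomposesᵇ x f₀ c₀)
      ≡⟨ indicator-true (Decomposition⇒decomposesᵇ dec₀) ⟩
    1 ∎
    where
    open ≡-Reasoning
    m₀≤n = Canonical⇒≤ (BlockConnectedPartition.is-canonical (Decomposition.bcp dec₀))
    decomposition : ∀ {m} (f : Vec (Fin m) n) c → T (decomposesᵇ x f c) → Decomposition K s x f c
    decomposition f c = decomposesᵇ⇒Decomposition {x = x} {f} {c}

  decompositions-of-non-coloring : ∀ {r} {x : Vec (Fin r) n} → ¬ Coloring K s x → decompositions x ≡ 0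
  decompositions-of-non-coloring {r} {x} ¬coloring =
    ∑-zero (upTo (suc n)) λ m → ∑-zero (allFinVecs m n) λ f → ∑-zero (allFinVecs r m) λ c →
      indicator-false λ t → ¬coloring (Decomposition⇒Coloring K s (decomposesᵇ⇒Decomposition {x = x} {f} {c} t))

  χˢ≡bcpSum : ∀ r → χˢ K s r ≡ bcpSum K s r
  χˢ≡bcpSum r = begin
    χˢ K s r                                 ≡⟨ count≡∑ (isColoring K s) X ⟩
    ∑[ x ← X ] indicator (isColoring K s x)  ≡⟨ ∑-cong X (λ x → sym (decompositions≡indicator x)) ⟩
    ∑[ x ← X ] decompositions x              ≡⟨ bcpSum≡∑decompositions r ⟨
    bcpSum K s r                             ∎
    where
    open ≡-Reasoning
    X = allFinVecs r n
    decompositions≡indicator : ∀ x → decompositions x ≡ indicator (isColoring K s x)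
    decompositions≡indicator x with T? (isColoring K s x)
    ... | yes t = trans (decompositions-of-coloring (isColoring⇒Coloring K s {x = x} t)) (sym (indicator-true t))
    ... | no ¬t = trans (decompositions-of-non-coloring (¬t ∘ Coloring⇒isColoring K s {x = x}))
                        (sym (indicator-false ¬t))

  BCP-term≤bcpSum : ∀ {m} {f : Vec (Fin m) n} → T (inBCP K s f) → ∀ r → chromaticPoly (G₀ K f) r ≤ bcpSum K s r
  BCP-term≤bcpSum {m} {f} t r = ≤-trans
    (∑-term≤ (λ f → chromaticPoly (G₀ K f) r) (∈-filter⁺ (T? ∘ inBCP K s) (∈-allFinVecs f) t))
    (∑-term≤ (λ m → ∑[ f ← filterᵇ (inBCP K s) (allFinVecs m n) ] chromaticPoly (G₀ K f) r)
             (∈-upTo⁺ (s≤s m≤n)))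
    where
    m≤n = Canonical⇒≤ (BlockConnectedPartition.is-canonical (inBCP⇒BlockConnectedPartition K s {f = f} t))

  BCP : Set
  BCP = Σ ℕ λ m → Σ (Vec (Fin m) n) λ f → T (inBCP K s f)

  bcpSum-positive : ∀ r → 0 < bcpSum K s r → ∃ λ ((_ , f , _) : BCP) → 0 < chromaticPoly (G₀ K f) r
  bcpSum-positive r pos =
    let m , _ , pos = ∑-positive (upTo (suc n)) pos
        f , f∈ , pos = ∑-positive (filterᵇ (inBCP K s) (allFinVecs m n)) pos
    in (m , f , proj₂ (∈-filter⁻ (T? ∘ inBCP K s) {xs = allFinVecs m n} f∈)) , pos

  IsLeastColors⇒IsMinBCPChromatic : ∀ {k} → IsLeastColors (χˢ K s) k → IsMinBCPChromatic K s k
  IsLeastColors⇒IsMinBCPChromatic least =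
    let ((m , f , t) , f-least) , minimal =
          IsLeastColors-of-sum (λ ((_ , f , _) : BCP) → chromaticPoly (G₀ K f))
            (λ (_ , f , t) r → subst (_ ≤_) (sym (χˢ≡bcpSum r)) (BCP-term≤bcpSum {f = f} t r))
            (λ r pos → bcpSum-positive r (subst (0 <_) (χˢ≡bcpSum r) pos)) least
    in (m , f , t , f-least) , λ m f t → minimal (m , f , t)

  discrete-Coloring : 1 ≤ s → Coloring K s (tabulate (λ v → v))
  discrete-Coloring 1≤s {σ} simplex (k , mono) = 2≰1 (begin
    2         ≤⟨ s≤s 1≤s ⟩
    suc s     ≡⟨ simplex-size K s simplex ⟨
    ∣ σ ∣     ≤⟨ p⊆q⇒∣p∣≤∣q∣ σ⊆⁅k⁆ ⟩
    ∣ ⁅ k ⁆ ∣ ≡⟨ ∣⁅x⁆∣≡1 k ⟩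
    1         ∎)
    where
    open ≤-Reasoning
    2≰1 : ¬ 2 ≤ 1
    2≰1 (s≤s ())
    σ⊆⁅k⁆ : σ ⊆ ⁅ k ⁆
    σ⊆⁅k⁆ {v} v∈σ = subst (_∈ ⁅ k ⁆) (trans (sym (mono v∈σ)) (lookup∘tabulate (λ v → v) v)) (x∈⁅x⁆ k)

  χˢ-positive : 1 ≤ s → 0 < χˢ K s n
  χˢ-positive 1≤s = begin
    1                                                    ≡⟨ indicator-true discrete-coloring ⟨
    indicator (isColoring K s discrete)                  ≤⟨ ∑-term≤ (indicator ∘ isColoring K s) (∈-allFinVecs discrete) ⟩
    ∑[ x ← allFinVecs n n ] indicator (isColoring K s x) ≡⟨ count≡∑ (isColoring K s) (allFinVecs n n) ⟨
    χˢ K s n                                             ∎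
    where
    open ≤-Reasoning
    discrete = tabulate (λ v → v)
    discrete-coloring = Coloring⇒isColoring K s {x = discrete} (discrete-Coloring 1≤s)

theorem2p5 : {n : ℕ} (K : SimplicialComplex n) → 1 ≤ n → (s : ℕ) → 1 ≤ s →
    ((r : ℕ) → 1 ≤ r → χˢ K s r ≡ bcpSum K s r)
    × Σ ℕ (λ k → IsLeastColors (χˢ K s) k × IsMinBCPChromatic K s k)
theorem2p5 {suc n} K _ s 1≤s =
  (λ r _ → χˢ≡bcpSum K s r) ,
  (let k , least = IsLeastColors-exists (χˢ K s) n (χˢ-positive K s 1≤s)
   in k , least , IsLeastColors⇒IsMinBCPChromatic K s least)
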